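{- Let $G$ be a connected finite $\delta$-hyperbolic graph and let $P(v,c)$ be a shortest path from an arbitrary vertex $v$ to an arbitrary central vertex $c\in C(G)$. Then either the length of $P(v,c)$ is at most $4\delta+1$, or the vertex $u$ of $P(v,c)$ at distance $2\delta+1$ from $v$ satisfies $e(u)<e(v)$.
   Context: $G$ is $\delta$-hyperbolic if for any four vertices $u,v,w,x$ the two larger of $d(u,v)+d(w,x)$, $d(u,w)+d(v,x)$, $d(u,x)+d(v,w)$ differ by at most $2\delta$ ($d$ = shortest-path distance); here $\delta$ is a nonnegative multiple of $1/2$ (so $2\delta$ is an integer). $e(v)=\max_u d(v,u)$, $rad(G)=\min_v e(v)$, $C(G)=\{v:e(v)=rad(G)\}$. -}

module Defs where

open import Data.Nat using (ℕ; zero; suc; _+_; _≤_; _<_; _⊔_; _⊓_)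
open import Data.Fin using (Fin; zero; suc; toℕ)
open import Data.Vec using (Vec; []; _∷_; head; last; lookup)
open import Data.List using (foldr; allFin)
open import Data.Product using (Σ; _×_; _,_)
open import Data.Empty using (⊥)
open import Data.Unit using (⊤)
open import Relation.Binary.PropositionalEquality using (_≡_)
open import Relation.Nullary using (¬_)

record Graph (n : ℕ) : Set₁ where
  field
    Adj     : Fin n → Fin n → Set
    sym     : ∀ {u v} → Adj u v → Adj v u
    irrefl  : ∀ {u} → ¬ Adj u u

module _ {n : ℕ} (G : Graph n) where
  open Graph G

  IsWalk : {k : ℕ} → Vec (Fin n) (suc k) → Set
  IsWalk (_ ∷ [])         = ⊤
  IsWalk (x ∷ y ∷ rest)   = Adj x y × IsWalk (y ∷ rest)

  WalkOfLength : Fin n → Fin n → ℕ → Set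
  WalkOfLength u v k =
    Σ (Vec (Fin n) (suc k)) λ p → IsWalk p × (head p ≡ u) × (last p ≡ v)

  Connected : Set
  Connected = ∀ u v → Σ ℕ λ k → WalkOfLength u v k

  IsShortestPathDistance : (Fin n → Fin n → ℕ) → Set
  IsShortestPathDistance d =
    ∀ u v → WalkOfLength u v (d u v) × (∀ k → WalkOfLength u v k → d u v ≤ k)

-- Median (second largest) and maximum of three numbers.
max3 : ℕ → ℕ → ℕ → ℕ
max3 a b c = a ⊔ b ⊔ c

mid3 : ℕ → ℕ → ℕ → ℕ
mid3 a b c = (a ⊓ b) ⊔ ((a ⊔ b) ⊓ c)

module _ {n : ℕ} (d : Fin n → Fin n → ℕ) where

  -- δ-hyperbolicity, with twoδ = 2δ ∈ ℕ: the two largest of the three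
  -- distance sums differ by at most 2δ.
  Hyperbolic : (twoδ : ℕ) → Set
  Hyperbolic twoδ = ∀ u v w x →
    max3 (d u v + d w x) (d u w + d v x) (d u x + d v w)
      ≤ mid3 (d u v + d w x) (d u w + d v x) (d u x + d v w) + twoδ

  ecc : Fin n → ℕ
  ecc v = foldr (λ u m → d v u ⊔ m) 0 (allFin n)

module _ {m : ℕ} (d : Fin (suc m) → Fin (suc m) → ℕ) where
  rad : ℕ
  rad = foldr (λ v r → ecc d v ⊓ r) (ecc d zero) (allFin (suc m))

  Central : Fin (suc m) → Set
  Central c = ecc d c ≡ rad

-- Let u be the vertex at distance 2δ+1 from v on a geodesic from v to a
-- central vertex c, so that d(u,c) = r ≥ 2δ+1 when the geodesic is longer
-- than 4δ+1. For any vertex x, the four-point condition on u, v, c, x gives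
--   d(u,x) + d(v,c) ≤ max(d(u,v) + d(c,x), d(u,c) + d(v,x)) + 2δ
--                   ≤ max(2δ+1 + e(c), r + e(v)) + 2δ = r + e(v) + 2δ,
-- using e(c) ≤ e(v). As d(v,c) = 2δ+1+r, this is d(u,x) < e(v).
module Submission where

open import Defs
open import Data.Nat using (ℕ; suc; _+_; _*_; _≤_; _<_; _⊔_; _⊓_; z≤n)
open import Data.Nat.Properties
open import Data.Nat.Tactic.RingSolver using (solve-∀)
open import Data.Fin using (Fin; toℕ)
open import Data.Vec using (Vec; head; last; lookup; []; _∷_)
open import Data.List using ([]; _∷_; foldr; allFin)
open import Data.List.Membership.Propositional using (_∈_)
open import Data.List.Membership.Propositional.Properties using (∈-allFin)
open import Data.List.Relation.Unary.Any using (here; there)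
open import Data.Product using (Σ; _×_; _,_; proj₂)
open import Data.Sum using (_⊎_; inj₁; inj₂)
open import Data.Unit using (tt)
open import Relation.Binary.PropositionalEquality
open import Relation.Nullary using (¬_; yes; no)

module _ {A : Set} (f : A → ℕ) where

  ≤-foldr-⊔ : ∀ {x xs} → x ∈ xs → f x ≤ foldr (λ y m → f y ⊔ m) 0 xs
  ≤-foldr-⊔ {xs = y ∷ _} (here refl) = m≤m⊔n (f y) _
  ≤-foldr-⊔ {xs = y ∷ _} (there x∈xs) = ≤-trans (≤-foldr-⊔ x∈xs) (m≤n⊔m (f y) _)

  foldr-⊔-< : ∀ {B} → 0 < B → (∀ x → f x < B) → ∀ xs → foldr (λ y m → f y ⊔ m) 0 xs < B
  foldr-⊔-< 0<B f<B []       = 0<B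
  foldr-⊔-< 0<B f<B (y ∷ xs) = ⊔-lub (f<B y) (foldr-⊔-< 0<B f<B xs)

  foldr-⊓-≤ : ∀ z {x xs} → x ∈ xs → foldr (λ y m → f y ⊓ m) z xs ≤ f x
  foldr-⊓-≤ z {xs = y ∷ _} (here refl) = m⊓n≤m (f y) _
  foldr-⊓-≤ z {xs = y ∷ _} (there x∈xs) = ≤-trans (m⊓n≤n (f y) _) (foldr-⊓-≤ z x∈xs)

module _ {m : ℕ} (d : Fin (suc m) → Fin (suc m) → ℕ) where

  dist-≤-ecc : ∀ u x → d u x ≤ ecc d u
  dist-≤-ecc u x = ≤-foldr-⊔ (d u) (∈-allFin x)

  ecc-< : ∀ {u B} → (∀ x → d u x < B) → ecc d u < B
  ecc-< {u} d<B = foldr-⊔-< (d u) (≤-<-trans z≤n (d<B u)) d<B (allFin (suc m))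

  central-ecc-≤ : ∀ {c} → Central d c → ∀ v → ecc d c ≤ ecc d v
  central-ecc-≤ central v =
    subst (_≤ ecc d v) (sym central) (foldr-⊓-≤ (ecc d) (ecc d Fin.zero) (∈-allFin v))

mid3≤⊔ : ∀ a b c → mid3 a b c ≤ a ⊔ b
mid3≤⊔ a b c = ⊔-lub (≤-trans (m⊓n≤m a b) (m≤m⊔n a b)) (m⊓n≤m (a ⊔ b) c)

module _ {n : ℕ} (d : Fin n → Fin n → ℕ) {twoδ : ℕ} (hyp : Hyperbolic d twoδ) where

  four-point : ∀ u v w x → d u x + d v w ≤ (d u v + d w x) ⊔ (d u w + d v x) + twoδ
  four-point u v w x =
    ≤-trans (m≤n⊔m (a ⊔ b) c) (≤-trans (hyp u v w x) (+-monoˡ-≤ twoδ (mid3≤⊔ a b c)))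
    where
    a = d u v + d w x
    b = d u w + d v x
    c = d u x + d v w

+-slack-< : ∀ x t r e → x + (suc t + r) ≤ r + e + t → x < e
+-slack-< x t r e h = +-cancelʳ-≤ (t + r) (suc x) e (begin
  suc x + (t + r)  ≡⟨ sym (+-suc x (t + r)) ⟩
  x + (suc t + r)  ≤⟨ h ⟩
  r + e + t        ≡⟨ rearrange r e t ⟩
  e + (t + r)      ∎)
  where
  open ≤-Reasoning
  rearrange : ∀ r e t → r + e + t ≡ e + (t + r)
  rearrange = solve-∀

ecc-decreases-toward-centre :
  ∀ {m} (d : Fin (suc m) → Fin (suc m) → ℕ) {t r : ℕ} {u v c : Fin (suc m)}
  → Hyperbolic d t → ecc d c ≤ ecc d v
  → d u v ≤ suc t → d u c ≤ r → suc t ≤ r → d v c ≡ suc t + r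
  → ecc d u < ecc d v
ecc-decreases-toward-centre d {t} {r} {u} {v} {c} hyp c≤v duv duc t<r dvc =
  ecc-< d λ x → +-slack-< (d u x) t r e (begin
    d u x + (suc t + r)                     ≡⟨ cong (d u x +_) (sym dvc) ⟩
    d u x + d v c                           ≤⟨ four-point d hyp u v c x ⟩
    (d u v + d c x) ⊔ (d u c + d v x) + t   ≤⟨ +-monoˡ-≤ t (⊔-mono-≤
                                                 (+-mono-≤ duv (≤-trans (dist-≤-ecc d c x) c≤v))
                                                 (+-mono-≤ duc (dist-≤-ecc d v x))) ⟩
    (suc t + e) ⊔ (r + e) + t               ≡⟨ cong (_+ t) (m≤n⇒m⊔n≡n (+-monoˡ-≤ e t<r)) ⟩
    r + e + t                               ∎)
  where
  open ≤-Reasoning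
  e = ecc d v

module _ {n : ℕ} (G : Graph n) where
  open Graph G renaming (sym to Adj-sym)

  data Path : Fin n → Fin n → ℕ → Set where
    []  : ∀ {u} → Path u u 0
    _∷_ : ∀ {u w v k} → Adj u w → Path w v k → Path u v (suc k)

  Path⇒Walk : ∀ {u v k} → Path u v k → WalkOfLength G u v k
  Path⇒Walk {u} [] = u ∷ [] , tt , refl , refl
  Path⇒Walk {u} (a ∷ p) with Path⇒Walk p
  ... | w ∷ ws , walk , refl , w-end = u ∷ w ∷ ws , (a , walk) , refl , w-end

  Walk⇒Path : ∀ {k} (p : Vec (Fin n) (suc k)) → IsWalk G p → Path (head p) (last p) k
  Walk⇒Path (_ ∷ [])     _          = []
  Walk⇒Path (_ ∷ w ∷ ws) (a , walk) = a ∷ Walk⇒Path (w ∷ ws) walk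

  snoc : ∀ {u v w k} → Path u v k → Adj v w → Path u w (suc k)
  snoc []      a = a ∷ []
  snoc (b ∷ p) a = b ∷ snoc p a

  reverse : ∀ {u v k} → Path u v k → Path v u k
  reverse []      = []
  reverse (a ∷ p) = snoc (reverse p) (Adj-sym a)

  splitAt : ∀ {k} (p : Vec (Fin n) (suc k)) → IsWalk G p → (i : Fin (suc k))
          → Σ ℕ λ r → Path (head p) (lookup p i) (toℕ i) × Path (lookup p i) (last p) r
                    × toℕ i + r ≡ k
  splitAt {k} p@(_ ∷ _) walk Fin.zero = k , [] , Walk⇒Path p walk , refl
  splitAt (_ ∷ w ∷ ws) (a , walk) (Fin.suc i) with splitAt (w ∷ ws) walk i
  ... | r , prefix , suffix , i+r≡k = r , a ∷ prefix , suffix , cong suc i+r≡k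

  module _ {d : Fin n → Fin n → ℕ} (isDist : IsShortestPathDistance G d) where

    dist-≤-length : ∀ {u v k} → Path u v k → d u v ≤ k
    dist-≤-length {u} {v} {k} p = proj₂ (isDist u v) k (Path⇒Walk p)

    walk-vertex-distances : ∀ {k} (p : Vec (Fin n) (suc k)) → IsWalk G p → (i : Fin (suc k))
      → Σ ℕ λ r → d (lookup p i) (head p) ≤ toℕ i × d (lookup p i) (last p) ≤ r
                × toℕ i + r ≡ k
    walk-vertex-distances p walk i with splitAt p walk i
    ... | r , prefix , suffix , i+r≡k =
      r , dist-≤-length (reverse prefix) , dist-≤-length suffix , i+r≡k

long-geodesic-remainder : ∀ t r → ¬ (suc t + r ≤ 2 * t + 1) → suc t ≤ r
long-geodesic-remainder t r k≰ = +-cancelˡ-≤ (suc t) (suc t) r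
  (subst (_≤ suc t + r) (double t) (≰⇒> k≰))
  where
  double : ∀ t → suc (2 * t + 1) ≡ suc t + suc t
  double = solve-∀

-- Connectedness is unused: it is implied by the existence of the distance function d.
corollary18 : (m : ℕ) (G : Graph (suc m)) (d : Fin (suc m) → Fin (suc m) → ℕ)
    → Connected G → IsShortestPathDistance G d
    → (twoδ : ℕ) → Hyperbolic d twoδ
    → (v c : Fin (suc m)) → Central d c
    → (k : ℕ) (P : Vec (Fin (suc m)) (suc k))
    → IsWalk G P → head P ≡ v → last P ≡ c → k ≡ d v c
    → k ≤ 2 * twoδ + 1
      ⊎ (∀ (i : Fin (suc k)) → toℕ i ≡ suc twoδ → ecc d (lookup P i) < ecc d v)
corollary18 m G d _ isDist t hyp _ _ central k P walk refl refl k≡dvc with k ≤? 2 * t + 1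
... | yes short = inj₁ short
... | no long   = inj₂ far-vertex
  where
  far-vertex : ∀ i → toℕ i ≡ suc t → ecc d (lookup P i) < ecc d (head P)
  far-vertex i i≡ with walk-vertex-distances G isDist P walk i
  ... | r , duv , duc , i+r≡k =
    ecc-decreases-toward-centre d hyp (central-ecc-≤ d central (head P))
      (subst (d (lookup P i) (head P) ≤_) i≡ duv) duc
      (long-geodesic-remainder t r (subst (λ l → ¬ l ≤ 2 * t + 1) (sym k≡) long))
      (trans (sym k≡dvc) (sym k≡))
    where
    k≡ : suc t + r ≡ k
    k≡ = trans (cong (_+ r) (sym i≡)) i+r≡k
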